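{- Let $T$ be a tree of order at least $2$. Then (i) $d_g'(T)=2$ if and only if $T$ has a perfect matching, and (ii) $d_g(T)=1$.
   Context: For a vertex $x$, $N[x]$ denotes its closed neighborhood. The domatic number game on a graph $G$ with palette $[k]=\{1,\dots,k\}$: two players, Alice and Bob, alternately choose a previously unchosen vertex of $G$ and assign it a color from $[k]$, until every vertex has been colored. Let $V_i$ be the set of vertices colored $i$. Alice wins if every $V_i$ ($i\in[k]$) is a dominating set of $G$, i.e. for every vertex $x$ and every color $c\in[k]$ some vertex of $N[x]$ has color $c$; otherwise Bob wins. In the $A$-game Alice moves first; in the $B$-game Bob moves first. The game domatic number $d_g(G)$ is the largest $k$ for which Alice has a winning strategy in the $A$-game with palette $[k]$, and the delayed game domatic number $d_g'(G)$ is the largest $k$ for which Alice has a winning strategy in the $B$-game with palette $[k]$. -}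

module Defs where

open import Data.Nat using (ℕ; zero; suc; _<_; _≥_)
open import Data.Fin using (Fin; _≟_)
open import Data.Maybe using (Maybe; just; nothing)
open import Data.List using (List; []; _∷_; length)
open import Data.List.Relation.Unary.Unique.Propositional using (Unique)
open import Data.Product using (Σ; ∃; _×_; _,_)
open import Data.Sum using (_⊎_)
open import Data.Empty using (⊥)
open import Relation.Nullary using (¬_; Dec; yes; no)
open import Relation.Binary.PropositionalEquality using (_≡_)

record Graph (n : ℕ) : Set₁ where
  field
    Adj   : Fin n → Fin n → Set
    adj?  : ∀ x y → Dec (Adj x y)
    sym   : ∀ {x y} → Adj x y → Adj y x
    irrefl : ∀ {x} → ¬ Adj x x
open Graph public

module _ {n : ℕ} (G : Graph n) where

  data Chain : List (Fin n) → Set where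
    []  : Chain []
    [_] : ∀ x → Chain (x ∷ [])
    _∷_ : ∀ {x y l} → Adj G x y → Chain (y ∷ l) → Chain (x ∷ y ∷ l)

  data Walk : Fin n → Fin n → Set where
    here : ∀ {u} → Walk u u
    step : ∀ {u w v} → Adj G u w → Walk w v → Walk u v

  Connected : Set
  Connected = ∀ u v → Walk u v

  IsCycle : List (Fin n) → Set
  IsCycle [] = ⊥
  IsCycle (x ∷ l) =
    Unique (x ∷ l) × Chain (x ∷ l) × 3 Data.Nat.≤ length (x ∷ l)
      × Σ (Fin n) (λ z → LastIs (x ∷ l) z × Adj G z x)
    where
      LastIs : List (Fin n) → Fin n → Set
      LastIs [] z = ⊥
      LastIs (y ∷ []) z = y ≡ z
      LastIs (y ∷ y' ∷ l') z = LastIs (y' ∷ l') z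

  Acyclic : Set
  Acyclic = ∀ l → ¬ IsCycle l

  IsTree : Set
  IsTree = Connected × Acyclic

  record PerfectMatching : Set₁ where
    field
      M       : Fin n → Fin n → Set
      M-sym   : ∀ {x y} → M x y → M y x
      M⊆E     : ∀ {x y} → M x y → Adj G x y
      covered : ∀ x → Σ (Fin n) λ y → M x y × (∀ z → M x z → z ≡ y)

  HasPerfectMatching : Set₁
  HasPerfectMatching = PerfectMatching

  Position : ℕ → Set
  Position k = Fin n → Maybe (Fin k)

  update : ∀ {k} → Position k → Fin n → Fin k → Position k
  update p v c x with x ≟ v
  ... | yes _ = just c
  ... | no  _ = p x

  AllColoured : ∀ {k} → Position k → Set
  AllColoured p = ∀ x → Σ _ λ c → p x ≡ just c

  AliceWinCondition : ∀ {k} → Position k → Set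
  AliceWinCondition {k} p =
    ∀ (x : Fin n) (c : Fin k) → Σ (Fin n) λ y → (y ≡ x ⊎ Adj G x y) × p y ≡ just c

  data Player : Set where
    alice bob : Player

  -- AliceWins k p pl : from position p with player pl to move, Alice has a
  -- winning strategy. (The game is finite, so this inductive definition is
  -- exactly the existence of a winning strategy.)
  data AliceWins (k : ℕ) : Position k → Player → Set where
    finished : ∀ {p pl} → AllColoured p → AliceWinCondition p → AliceWins k p pl
    aliceMove : ∀ {p} (v : Fin n) (c : Fin k) → p v ≡ nothing →
                AliceWins k (update p v c) bob → AliceWins k p alice
    bobMove : ∀ {p} → ¬ AllColoured p →
              (∀ (v : Fin n) (c : Fin k) → p v ≡ nothing →
                 AliceWins k (update p v c) alice) →
              AliceWins k p bob

  empty : ∀ {k} → Position k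
  empty _ = nothing

  AliceWinsAGame AliceWinsBGame : ℕ → Set
  AliceWinsAGame k = AliceWins k empty alice
  AliceWinsBGame k = AliceWins k empty bob

  GameDomaticNumberIs : ℕ → Set
  GameDomaticNumberIs m = AliceWinsAGame m × (∀ k → m < k → ¬ AliceWinsAGame k)

  DelayedGameDomaticNumberIs : ℕ → Set
  DelayedGameDomaticNumberIs m = AliceWinsBGame m × (∀ k → m < k → ¬ AliceWinsBGame k)

{-# OPTIONS --safe #-}
-- With one colour Alice cannot lose, and with three or more she loses because a leaf sees at
-- most two vertices.  For two colours Bob's weapon is a blocked vertex x: once every vertex of
-- N[x] carries a colour other than c, x never sees c.  Induct on induced subforests S.  An
-- isolated vertex is fatal for Alice.  Otherwise S has a leaf v₀ with support v₁, and a win of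
-- Alice on S gives one on S − {v₀, v₁}: should she colour v₀ or v₁, Bob repeats her colour on
-- the other, blocking v₀; should S − {v₀, v₁} get coloured with some x not seeing c, Bob
-- colours v₁ with the other colour, blocking x.  A perfect matching of S − {v₀, v₁} extends by
-- v₀v₁, so Bob wins the B-game on a forest without a perfect matching; he wins the A-game on
-- every nonempty forest, since on a single edge Alice has to open.  Given a perfect matching,
-- Alice answers each move of Bob with the other colour on the partner vertex.
module Submission where

open import Defs
open import Data.Nat using (ℕ; _≥_; zero; suc; _+_; _<_; s≤s; z≤n)
open import Data.Product using (_×_; Σ; ∃; ∃₂; _,_; proj₁; proj₂)
open import Function.Bundles using (_⇔_; mk⇔)

open import Data.Empty using (⊥; ⊥-elim)
open import Data.Fin using (Fin; zero; suc; _≟_; opposite)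
open import Data.Fin.Properties using (any?; opposite-involutive)
open import Data.Fin.Subset
  using (Subset; _∈_; _∉_; _─_; _-_; _⊂_; ⊤; Nonempty; Empty; inside; outside)
open import Data.Fin.Subset.Induction using (Acc; acc; ⊂-wellFounded)
open import Data.Fin.Subset.Properties
  using (_∈?_; ∈⊤; nonempty?; x∈⁅x⁆; x∈p∧x≢y⇒x∈p-y; x∈p⇒p-x⊂p; p─q⊆p; ⊂-trans)
open import Data.List using (List; []; _∷_; _++_)
open import Data.List.Properties using (++-assoc)
open import Data.List.Membership.Propositional using () renaming (_∈_ to _∈ₗ_; _∉_ to _∉ₗ_)
open import Data.List.Membership.Propositional.Properties using (∈-∃++)
open import Data.List.Relation.Unary.All using ([]; _∷_)
open import Data.List.Relation.Unary.All.Properties using (¬Any⇒All¬; ++⁻ˡ)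
open import Data.List.Relation.Unary.AllPairs using ([]; _∷_)
open import Data.List.Relation.Unary.Any using (here; there) renaming (any? to anyₗ?)
open import Data.List.Relation.Unary.Unique.Propositional using (Unique)
open import Data.Maybe using (Maybe; just; nothing) renaming (map to mapMaybe)
open import Data.Maybe.Properties using (just-injective; ≡-dec)
open import Data.Sum using (_⊎_; inj₁; inj₂)
import Data.Unit as Unit
open import Data.Vec using (_∷_; here; there)
open import Function using (_∘_; case_of_)
open import Relation.Nullary using (¬_; Dec; yes; no; contradiction)
open import Relation.Nullary.Decidable using (_×-dec_; _⊎-dec_; ¬?; decidable-stable)
import Relation.Binary.PropositionalEquality as ≡
open ≡ using (_≡_; _≢_; refl; trans; cong; subst; ≢-sym)
open ≡.≡-Reasoning

opposite-≢ : (c : Fin 2) → opposite c ≢ c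
opposite-≢ zero       ()
opposite-≢ (suc zero) ()

≡-or-≡-opposite : (c d : Fin 2) → c ≡ d ⊎ c ≡ opposite d
≡-or-≡-opposite zero       zero       = inj₁ refl
≡-or-≡-opposite zero       (suc zero) = inj₂ refl
≡-or-≡-opposite (suc zero) zero       = inj₂ refl
≡-or-≡-opposite (suc zero) (suc zero) = inj₁ refl

pigeonhole₃ : ∀ {A : Set} {a b y₀ y₁ y₂ : A} →
              y₀ ≡ a ⊎ y₀ ≡ b → y₁ ≡ a ⊎ y₁ ≡ b → y₂ ≡ a ⊎ y₂ ≡ b →
              y₀ ≡ y₁ ⊎ y₀ ≡ y₂ ⊎ y₁ ≡ y₂
pigeonhole₃ (inj₁ refl) (inj₁ refl) _           = inj₁ refl
pigeonhole₃ (inj₂ refl) (inj₂ refl) _           = inj₁ refl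
pigeonhole₃ (inj₁ refl) (inj₂ refl) (inj₁ refl) = inj₂ (inj₁ refl)
pigeonhole₃ (inj₁ refl) (inj₂ refl) (inj₂ refl) = inj₂ (inj₂ refl)
pigeonhole₃ (inj₂ refl) (inj₁ refl) (inj₁ refl) = inj₂ (inj₂ refl)
pigeonhole₃ (inj₂ refl) (inj₁ refl) (inj₂ refl) = inj₂ (inj₁ refl)

≢nothing⇒just : ∀ {A : Set} {m : Maybe A} → m ≢ nothing → ∃ λ a → m ≡ just a
≢nothing⇒just {m = just a}  _          = a , refl
≢nothing⇒just {m = nothing} m≢nothing = contradiction refl m≢nothing

x∈p─q⇒x∉q : ∀ {n} {p q : Subset n} {x} → x ∈ p ─ q → x ∉ q
x∈p─q⇒x∉q {p = _ ∷ _} {outside ∷ _} here       ()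
x∈p─q⇒x∉q {p = _ ∷ _} {inside ∷ _}  ()         here
x∈p─q⇒x∉q {p = _ ∷ _} {_ ∷ _}       (there x∈) (there x∈q) = x∈p─q⇒x∉q x∈ x∈q

x∈p-y⇒x≢y : ∀ {n} {p : Subset n} {x y} → x ∈ p - y → x ≢ y
x∈p-y⇒x≢y x∈ refl = x∈p─q⇒x∉q x∈ (x∈⁅x⁆ _)

unique-++⁻ˡ : ∀ {A : Set} (xs : List A) {ys} → Unique (xs ++ ys) → Unique xs
unique-++⁻ˡ []       _         = []
unique-++⁻ˡ (x ∷ xs) (x∉ ∷ u) = ++⁻ˡ xs x∉ ∷ unique-++⁻ˡ xs u

completeGraph : ∀ {n} → Graph n
completeGraph = record
  { Adj    = _≢_
  ; adj?   = λ x y → ¬? (x ≟ y)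
  ; sym    = ≢-sym
  ; irrefl = λ x≢x → x≢x refl
  }

unique⇒chain : ∀ {n} {xs : List (Fin n)} → Unique xs → Chain completeGraph xs
unique⇒chain {xs = []}         []                = []
unique⇒chain {xs = x ∷ []}     _                 = [ x ]
unique⇒chain {xs = x ∷ y ∷ xs} ((x≢y ∷ _) ∷ u) = x≢y ∷ unique⇒chain u

-- The closing condition of IsCycle mentions only the list of vertices, so it can be
-- established in the complete graph, where every repetition-free list is a chain.
cycleInCompleteGraph : ∀ {n} {x a : Fin n} ys {z} → Unique (x ∷ a ∷ ys ++ z ∷ []) →
                       Σ (IsCycle completeGraph (x ∷ a ∷ ys ++ z ∷ [])) λ c →
                         proj₁ (proj₂ (proj₂ (proj₂ c))) ≡ z
cycleInCompleteGraph []       u@((_ ∷ x≢z ∷ []) ∷ _) =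
  (u , unique⇒chain u , s≤s (s≤s (s≤s z≤n)) , _ , refl , x≢z ∘ ≡.sym) , refl
cycleInCompleteGraph (_ ∷ ys) u@((_ ∷ x∉) ∷ _ ∷ u′)
  with cycleInCompleteGraph ys (x∉ ∷ u′)
... | (_ , _ , _ , z′ , closes , z′≢x) , z′≡z =
  (u , unique⇒chain u , s≤s (s≤s (s≤s z≤n)) , z′ , closes , z′≢x) , z′≡z

module _ {n : ℕ} (G : Graph n) where

  closedPath⇒cycle : ∀ {x a} ys {z} →
                     Unique (x ∷ a ∷ ys ++ z ∷ []) → Chain G (x ∷ a ∷ ys ++ z ∷ []) → Adj G z x →
                     IsCycle G (x ∷ a ∷ ys ++ z ∷ [])
  closedPath⇒cycle ys u ch zx with cycleInCompleteGraph ys u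
  ... | (_ , _ , long , _ , closes , _) , refl = u , ch , long , _ , closes , zx

  chain-++⁻ˡ : ∀ xs {ys} → Chain G (xs ++ ys) → Chain G xs
  chain-++⁻ˡ []           _          = []
  chain-++⁻ˡ (x ∷ [])     _          = [ x ]
  chain-++⁻ˡ (x ∷ y ∷ xs) (xy ∷ ch) = xy ∷ chain-++⁻ˡ (y ∷ xs) ch

  -- The game on an induced subgraph

  N[_] : Fin n → Fin n → Set
  N[ x ] y = y ≡ x ⊎ Adj G x y

  update-≡ : ∀ {k} (p : Position G k) v c → update G p v c v ≡ just c
  update-≡ p v c with v ≟ v
  ... | yes _   = refl
  ... | no v≢v = contradiction refl v≢v

  update-≢ : ∀ {k} (p : Position G k) {v} c {x} → x ≢ v → update G p v c x ≡ p x
  update-≢ p {v} c {x} x≢v with x ≟ v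
  ... | yes x≡v = contradiction x≡v x≢v
  ... | no _    = refl

  update-keeps-colour : ∀ {k} {p : Position G k} {v c x d} →
                        p v ≡ nothing → p x ≡ just d → update G p v c x ≡ just d
  update-keeps-colour {p = p} {c = c} pv px =
    trans (update-≢ p c λ { refl → case trans (≡.sym pv) px of λ () }) px

  uncolouredIn? : ∀ {k} (S : Subset n) (p : Position G k) →
                  Dec (∃ λ v → v ∈ S × p v ≡ nothing)
  uncolouredIn? S p = any? λ v → v ∈? S ×-dec ≡-dec _≟_ (p v) nothing

  ¬uncoloured⇒allColoured : ∀ {k} {p : Position G k} →
                            ¬ (∃ λ v → v ∈ ⊤ × p v ≡ nothing) → AllColoured G p
  ¬uncoloured⇒allColoured none x = ≢nothing⇒just λ px → none (x , ∈⊤ , px)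

  uncoloured⇒¬allColoured : ∀ {k} {p : Position G k} {v} → p v ≡ nothing → ¬ AllColoured G p
  uncoloured⇒¬allColoured pv all = case trans (≡.sym pv) (proj₂ (all _)) of λ ()

  Sees : ∀ {k} → Subset n → Position G k → Fin n → Fin k → Set
  Sees S p x c = ∃ λ y → y ∈ S × N[ x ] y × p y ≡ just c

  Dominating : ∀ {k} → Subset n → Position G k → Set
  Dominating S p = ∀ {x} → x ∈ S → ∀ c → Sees S p x c

  sees? : ∀ {k} (S : Subset n) (p : Position G k) x c → Dec (Sees S p x c)
  sees? S p x c =
    any? λ y → y ∈? S ×-dec (y ≟ x ⊎-dec adj? G x y) ×-dec ≡-dec _≟_ (p y) (just c)

  dominating-or-unseen : ∀ {k} (S : Subset n) (p : Position G k) →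
                         Dominating S p ⊎ ∃₂ λ x c → x ∈ S × ¬ Sees S p x c
  dominating-or-unseen S p with any? (λ x → any? λ c → x ∈? S ×-dec ¬? (sees? S p x c))
  ... | yes unseen = inj₂ unseen
  ... | no none    = inj₁ λ {x} x∈S c →
    decidable-stable (sees? S p x c) λ unseen → none (x , c , x∈S , unseen)

  dominating-update : ∀ {k S} {p : Position G k} {v c} →
                      p v ≡ nothing → Dominating S p → Dominating S (update G p v c)
  dominating-update {p = p} {v} {c} pv dom x∈S c′ with dom x∈S c′
  ... | y , y∈S , near , py = y , y∈S , near , update-keeps-colour {p = p} {v} {c} pv py

  same-seer⇒same-colour : ∀ {k S} {p : Position G k} {x c d} →
                          (σ : Sees S p x c) (τ : Sees S p x d) → proj₁ σ ≡ proj₁ τ → c ≡ d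
  same-seer⇒same-colour (_ , _ , _ , py) (_ , _ , _ , py′) refl =
    just-injective (trans (≡.sym py) py′)

  -- Alice is credited as soon as every colour class dominates G[S]; this is harmless, since
  -- domination survives further colouring.
  data AliceWinsOn (S : Subset n) (k : ℕ) : Position G k → Player G → Set where
    dominating : ∀ {p pl} → Dominating S p → AliceWinsOn S k p pl
    aliceMove  : ∀ {p} v c → v ∈ S → p v ≡ nothing →
                 AliceWinsOn S k (update G p v c) bob → AliceWinsOn S k p alice
    bobMove    : ∀ {p} → (∃ λ v → v ∈ S × p v ≡ nothing) →
                 (∀ v c → v ∈ S → p v ≡ nothing → AliceWinsOn S k (update G p v c) alice) →
                 AliceWinsOn S k p bob

  aliceWins⇒aliceWinsOn⊤ : ∀ {k p pl} → AliceWins G k p pl → AliceWinsOn ⊤ k p pl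
  aliceWins⇒aliceWinsOn⊤ (finished _ win) = dominating λ {x} _ c →
    let y , near , py = win x c in y , ∈⊤ , near , py
  aliceWins⇒aliceWinsOn⊤ (aliceMove v c pv next) =
    aliceMove v c ∈⊤ pv (aliceWins⇒aliceWinsOn⊤ next)
  aliceWins⇒aliceWinsOn⊤ {p = p} (bobMove notAll next) with uncolouredIn? ⊤ p
  ... | yes move = bobMove move λ v c _ pv → aliceWins⇒aliceWinsOn⊤ (next v c pv)
  ... | no none  = contradiction (¬uncoloured⇒allColoured none) notAll

  bobMove⁻ : ∀ {S k p} → AliceWinsOn S k p bob →
             ∀ {v} → v ∈ S → p v ≡ nothing → ∀ c → AliceWinsOn S k (update G p v c) alice
  bobMove⁻ (dominating dom) _   pv c = dominating (dominating-update pv dom)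
  bobMove⁻ (bobMove _ next) v∈S pv c = next _ c v∈S pv

  -- Strategies for Bob

  module _ {S : Subset n} {k : ℕ} (c₀ : Fin k) (Inv : Position G k → Set)
           (Inv-update : ∀ {p v c} → p v ≡ nothing → Inv p → Inv (update G p v c))
           (Inv⇒¬dominating : ∀ {p} → Inv p → ¬ Dominating S p) where

    invariant⇒¬aliceWinsOn : ∀ {p pl} → Inv p → ¬ AliceWinsOn S k p pl
    invariant⇒¬aliceWinsOn inv (dominating dom) = Inv⇒¬dominating inv dom
    invariant⇒¬aliceWinsOn inv (aliceMove _ _ _ pv next) =
      invariant⇒¬aliceWinsOn (Inv-update pv inv) next
    invariant⇒¬aliceWinsOn inv (bobMove (v , v∈S , pv) next) =
      invariant⇒¬aliceWinsOn (Inv-update pv inv) (next v c₀ v∈S pv)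

  undominatable⇒¬aliceWinsOn : ∀ {S k} → Fin k → (∀ {p} → ¬ Dominating {k} S p) →
                               ∀ {p pl} → ¬ AliceWinsOn S k p pl
  undominatable⇒¬aliceWinsOn c₀ never =
    invariant⇒¬aliceWinsOn c₀ (λ _ → Unit.⊤) (λ _ _ → Unit.tt) (λ _ → never) Unit.tt

  Blocked : ∀ {k} → Subset n → Position G k → Fin n → Fin k → Set
  Blocked S p x c = ∀ {y} → y ∈ S → N[ x ] y → ∃ λ d → p y ≡ just d × d ≢ c

  blocked⇒¬aliceWinsOn : ∀ {S k} {p : Position G k} {pl x c} →
                         x ∈ S → Blocked S p x c → ¬ AliceWinsOn S k p pl
  blocked⇒¬aliceWinsOn {S} {x = x} {c} x∈S =
    invariant⇒¬aliceWinsOn c (λ p → Blocked S p x c) stillBlocked unseen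
    where
      stillBlocked : ∀ {p v c′} → p v ≡ nothing → Blocked S p x c → Blocked S (update G p v c′) x c
      stillBlocked {p} {v} {c′} pv blocked y∈S near with blocked y∈S near
      ... | d , py , d≢c = d , update-keeps-colour {p = p} {v} {c′} pv py , d≢c
      unseen : ∀ {p} → Blocked S p x c → ¬ Dominating S p
      unseen blocked dom with dom x∈S c
      ... | y , y∈S , near , py with blocked y∈S near
      ...   | d , py′ , d≢c = d≢c (just-injective (trans (≡.sym py′) py))

  LeafIn : Subset n → Fin n → Fin n → Set
  LeafIn S l s = ∀ {y} → y ∈ S → Adj G l y → y ≡ s

  IsolatedIn : Subset n → Fin n → Set
  IsolatedIn S x = ∀ {y} → y ∈ S → ¬ Adj G x y

  near-leaf : ∀ {S l s y} → LeafIn S l s → y ∈ S → N[ l ] y → y ≡ l ⊎ y ≡ s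
  near-leaf leaf y∈S (inj₁ y≡l) = inj₁ y≡l
  near-leaf leaf y∈S (inj₂ ly)  = inj₂ (leaf y∈S ly)

  near-isolated : ∀ {S x y} → IsolatedIn S x → y ∈ S → N[ x ] y → y ≡ x
  near-isolated iso y∈S (inj₁ y≡x) = y≡x
  near-isolated iso y∈S (inj₂ xy)  = contradiction xy (iso y∈S)

  isolated⇒¬dominating : ∀ {S x} {p : Position G 2} → x ∈ S → IsolatedIn S x → ¬ Dominating S p
  isolated⇒¬dominating x∈S iso dom with dom x∈S zero | dom x∈S (suc zero)
  ... | σ₀@(_ , y₀∈S , near₀ , _) | σ₁@(_ , y₁∈S , near₁ , _) =
    case same-seer⇒same-colour σ₀ σ₁ (trans (near-isolated iso y₀∈S near₀)
                                            (≡.sym (near-isolated iso y₁∈S near₁))) of λ ()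

  leaf⇒¬dominating : ∀ {S l s k} {p : Position G (3 + k)} → l ∈ S → LeafIn S l s → ¬ Dominating S p
  leaf⇒¬dominating {S} {l} {s} {k} l∈S leaf dom =
    noCoincidence (pigeonhole₃ (side zero) (side (suc zero)) (side (suc (suc zero))))
    where
      seer : Fin (3 + k) → Fin n
      seer c = proj₁ (dom l∈S c)
      side : ∀ c → seer c ≡ l ⊎ seer c ≡ s
      side c with dom l∈S c
      ... | _ , y∈S , near , _ = near-leaf leaf y∈S near
      distinct : ∀ {c d} → seer c ≡ seer d → c ≡ d
      distinct {c} {d} = same-seer⇒same-colour (dom l∈S c) (dom l∈S d)
      noCoincidence : seer zero ≡ seer (suc zero) ⊎ seer zero ≡ seer (suc (suc zero))
                        ⊎ seer (suc zero) ≡ seer (suc (suc zero)) → ⊥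
      noCoincidence (inj₁ e)        = case distinct e of λ ()
      noCoincidence (inj₂ (inj₁ e)) = case distinct e of λ ()
      noCoincidence (inj₂ (inj₂ e)) = case distinct e of λ ()

  monochromaticLeafEdge⇒¬aliceWinsOn : ∀ {S l s c} {p : Position G 2} {pl} →
                                       l ∈ S → LeafIn S l s → p l ≡ just c → p s ≡ just c →
                                       ¬ AliceWinsOn S 2 p pl
  monochromaticLeafEdge⇒¬aliceWinsOn {c = c} l∈S leaf pl ps = blocked⇒¬aliceWinsOn l∈S blocked
    where
      blocked : Blocked _ _ _ (opposite c)
      blocked y∈S near with near-leaf leaf y∈S near
      ... | inj₁ refl = c , pl , opposite-≢ c ∘ ≡.sym
      ... | inj₂ refl = c , ps , opposite-≢ c ∘ ≡.sym

  record PerfectMatchingOn (S : Subset n) : Set where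
    field
      partner            : Fin n → Fin n
      partner-∈          : ∀ {x} → x ∈ S → partner x ∈ S
      partner-adj        : ∀ {x} → x ∈ S → Adj G x (partner x)
      partner-involutive : ∀ {x} → x ∈ S → partner (partner x) ≡ x

  emptyMatching : ∀ {S} → Empty S → PerfectMatchingOn S
  emptyMatching ∅ = record
    { partner            = λ x → x
    ; partner-∈          = λ x∈S → ⊥-elim (∅ (_ , x∈S))
    ; partner-adj        = λ x∈S → ⊥-elim (∅ (_ , x∈S))
    ; partner-involutive = λ x∈S → ⊥-elim (∅ (_ , x∈S))
    }

  perfectMatchingOn⊤⇒perfectMatching : PerfectMatchingOn ⊤ → PerfectMatching G
  perfectMatchingOn⊤⇒perfectMatching m = record
    { M       = λ x y → partner x ≡ y
    ; M-sym   = λ { refl → partner-involutive ∈⊤ }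
    ; M⊆E     = λ { refl → partner-adj ∈⊤ }
    ; covered = λ x → partner x , refl , λ _ → ≡.sym
    }
    where open PerfectMatchingOn m

  perfectMatching⇒perfectMatchingOn⊤ : PerfectMatching G → PerfectMatchingOn ⊤
  perfectMatching⇒perfectMatchingOn⊤ pm = record
    { partner            = partner
    ; partner-∈          = λ _ → ∈⊤
    ; partner-adj        = λ {x} _ → M⊆E (matched x)
    ; partner-involutive = λ {x} _ → ≡.sym (proj₂ (proj₂ (covered (partner x))) x (M-sym (matched x)))
    }
    where
      open PerfectMatching pm
      partner : Fin n → Fin n
      partner x = proj₁ (covered x)
      matched : ∀ x → M x (partner x)
      matched x = proj₁ (proj₂ (covered x))

  -- Removing a pendant edge

  record LeafEdgeIn (S : Subset n) : Set where
    field
      leaf support : Fin n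
      leaf∈S       : leaf ∈ S
      support∈S    : support ∈ S
      leaf-adj     : Adj G leaf support
      leaf-only    : LeafIn S leaf support

  module Pruning {S : Subset n} (e : LeafEdgeIn S) where
    open LeafEdgeIn e

    pruned : Subset n
    pruned = S - leaf - support

    leaf≢support : leaf ≢ support
    leaf≢support refl = irrefl G leaf-adj

    ∈pruned⁺ : ∀ {x} → x ∈ S → x ≢ leaf → x ≢ support → x ∈ pruned
    ∈pruned⁺ x∈S x≢l x≢s = x∈p∧x≢y⇒x∈p-y (x∈p∧x≢y⇒x∈p-y x∈S x≢l) x≢s

    ∈pruned⁻ : ∀ {x} → x ∈ pruned → x ∈ S × x ≢ leaf × x ≢ support
    ∈pruned⁻ x∈ =
      p─q⊆p _ _ (p─q⊆p _ _ x∈) , x∈p-y⇒x≢y (p─q⊆p _ _ x∈) , x∈p-y⇒x≢y x∈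

    pruned⊂S : pruned ⊂ S
    pruned⊂S = ⊂-trans (x∈p⇒p-x⊂p (x∈p∧x≢y⇒x∈p-y support∈S (≢-sym leaf≢support)))
                       (x∈p⇒p-x⊂p leaf∈S)

    near-pruned⇒≢leaf : ∀ {x y} → x ∈ pruned → N[ x ] y → y ≢ leaf
    near-pruned⇒≢leaf x∈ (inj₁ refl) refl = proj₁ (proj₂ (∈pruned⁻ x∈)) refl
    near-pruned⇒≢leaf x∈ (inj₂ xy)   refl =
      proj₂ (proj₂ (∈pruned⁻ x∈)) (leaf-only (proj₁ (∈pruned⁻ x∈)) (sym G xy))

    EdgeUncoloured : Position G 2 → Set
    EdgeUncoloured p = p leaf ≡ nothing × p support ≡ nothing

    edgeUncoloured-update : ∀ {p v c} → v ∈ pruned → EdgeUncoloured p →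
                            EdgeUncoloured (update G p v c)
    edgeUncoloured-update {p} {c = c} v∈ (pl , ps) =
      trans (update-≢ p c (≢-sym (proj₁ (proj₂ (∈pruned⁻ v∈))))) pl ,
      trans (update-≢ p c (≢-sym (proj₂ (proj₂ (∈pruned⁻ v∈))))) ps

    edgeUncoloured⇒¬dominating : ∀ {p} → EdgeUncoloured p → ¬ Dominating S p
    edgeUncoloured⇒¬dominating (pl , ps) dom with dom leaf∈S zero
    ... | y , y∈S , near , py with near-leaf leaf-only y∈S near
    ...   | inj₁ refl = case trans (≡.sym pl) py of λ ()
    ...   | inj₂ refl = case trans (≡.sym ps) py of λ ()

    aliceMovesInPruned : ∀ {p v c} → EdgeUncoloured p → v ∈ S →
                         AliceWinsOn S 2 (update G p v c) bob → v ∈ pruned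
    aliceMovesInPruned {p} {v} {c} (pl , ps) v∈S next with v ≟ leaf | v ≟ support
    ... | yes refl | _ =
      ⊥-elim (monochromaticLeafEdge⇒¬aliceWinsOn leaf∈S leaf-only
                (update-keeps-colour {p = update G p leaf c} {support} {c} {leaf} ps′ (update-≡ p leaf c))
                (update-≡ _ support c)
                (bobMove⁻ next support∈S ps′ c))
      where
        ps′ : update G p leaf c support ≡ nothing
        ps′ = trans (update-≢ p c (≢-sym leaf≢support)) ps
    ... | no _ | yes refl =
      ⊥-elim (monochromaticLeafEdge⇒¬aliceWinsOn leaf∈S leaf-only
                (update-≡ _ leaf c)
                (update-keeps-colour {p = update G p support c} {leaf} {c} {support} pl′ (update-≡ p support c))
                (bobMove⁻ next leaf∈S pl′ c))
      where
        pl′ : update G p support c leaf ≡ nothing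
        pl′ = trans (update-≢ p c leaf≢support) pl
    ... | no v≢l | no v≢s = ∈pruned⁺ v∈S v≢l v≢s

    blockedBySupport : ∀ {p : Position G 2} {x c} → x ∈ pruned →
                       ¬ (∃ λ v → v ∈ pruned × p v ≡ nothing) → ¬ Sees pruned p x c →
                       Blocked S (update G p support (opposite c)) x c
    blockedBySupport {p} {x} {c} x∈ full unseen {y} y∈S near = byCases (y ≟ support)
      where
        y∈pruned : y ≢ support → y ∈ pruned
        y∈pruned = ∈pruned⁺ y∈S (near-pruned⇒≢leaf x∈ near)
        byCases : Dec (y ≡ support) → ∃ λ d → update G p support (opposite c) y ≡ just d × d ≢ c
        byCases (yes refl) = opposite c , update-≡ p support (opposite c) , opposite-≢ c
        byCases (no y≢s) with ≢nothing⇒just {m = p y} (λ py → full (y , y∈pruned y≢s , py))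
        ... | d , py = d , trans (update-≢ p (opposite c) y≢s) py ,
                       λ { refl → unseen (y , y∈pruned y≢s , near , py) }

    aliceWinsOn-pruned : ∀ {p pl} → EdgeUncoloured p → AliceWinsOn S 2 p pl → AliceWinsOn pruned 2 p pl
    aliceWinsOn-pruned edge (dominating dom) = ⊥-elim (edgeUncoloured⇒¬dominating edge dom)
    aliceWinsOn-pruned edge (aliceMove v c v∈S pv next) =
      aliceMove v c v∈pruned pv (aliceWinsOn-pruned (edgeUncoloured-update v∈pruned edge) next)
      where
        v∈pruned : v ∈ pruned
        v∈pruned = aliceMovesInPruned edge v∈S next
    aliceWinsOn-pruned {p} edge (bobMove _ next) with uncolouredIn? pruned p
    ... | yes move = bobMove move λ v c v∈ pv →
      aliceWinsOn-pruned (edgeUncoloured-update v∈ edge) (next v c (proj₁ (∈pruned⁻ v∈)) pv)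
    ... | no full with dominating-or-unseen pruned p
    ...   | inj₁ dom                   = dominating dom
    ...   | inj₂ (x , c , x∈ , unseen) =
      ⊥-elim (blocked⇒¬aliceWinsOn (proj₁ (∈pruned⁻ x∈)) (blockedBySupport x∈ full unseen)
                (next support (opposite c) support∈S (proj₂ edge)))

    onlyEdge⇒¬aliceWinsOn : ∀ {p} → Empty pruned → EdgeUncoloured p → ¬ AliceWinsOn S 2 p alice
    onlyEdge⇒¬aliceWinsOn _ edge (dominating dom) = edgeUncoloured⇒¬dominating edge dom
    onlyEdge⇒¬aliceWinsOn ∅ edge (aliceMove v _ v∈S _ next) =
      ∅ (v , aliceMovesInPruned edge v∈S next)

    matchEdge : (Fin n → Fin n) → Fin n → Fin n
    matchEdge m x with x ≟ leaf | x ≟ support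
    ... | yes _ | _     = support
    ... | no _  | yes _ = leaf
    ... | no _  | no _  = m x

    matchEdge-leaf : ∀ m → matchEdge m leaf ≡ support
    matchEdge-leaf m with leaf ≟ leaf
    ... | yes _   = refl
    ... | no l≢l = contradiction refl l≢l

    matchEdge-support : ∀ m → matchEdge m support ≡ leaf
    matchEdge-support m with support ≟ leaf | support ≟ support
    ... | yes s≡l | _      = contradiction (≡.sym s≡l) leaf≢support
    ... | no _    | yes _  = refl
    ... | no _    | no s≢s = contradiction refl s≢s

    matchEdge-pruned : ∀ m {x} → x ∈ pruned → matchEdge m x ≡ m x
    matchEdge-pruned m {x} x∈ with x ≟ leaf | x ≟ support
    ... | yes x≡l | _       = contradiction x≡l (proj₁ (proj₂ (∈pruned⁻ x∈)))
    ... | no _    | yes x≡s = contradiction x≡s (proj₂ (proj₂ (∈pruned⁻ x∈)))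
    ... | no _    | no _    = refl

    extendMatching : PerfectMatchingOn pruned → PerfectMatchingOn S
    extendMatching m = record
      { partner            = matchEdge partner
      ; partner-∈          = λ x∈S → proj₁ (matchedAt x∈S)
      ; partner-adj        = λ x∈S → proj₁ (proj₂ (matchedAt x∈S))
      ; partner-involutive = λ x∈S → proj₂ (proj₂ (matchedAt x∈S))
      }
      where
        open PerfectMatchingOn m
        Matched : Fin n → Fin n → Set
        Matched x y = y ∈ S × Adj G x y × matchEdge partner y ≡ x
        matchedAt : ∀ {x} → x ∈ S → Matched x (matchEdge partner x)
        matchedAt {x} x∈S = byCases (x ≟ leaf) (x ≟ support)
          where
            byCases : Dec (x ≡ leaf) → Dec (x ≡ support) → Matched x (matchEdge partner x)
            byCases (yes refl) _ = subst (Matched leaf) (≡.sym (matchEdge-leaf partner))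
              (support∈S , leaf-adj , matchEdge-support partner)
            byCases (no _) (yes refl) = subst (Matched support) (≡.sym (matchEdge-support partner))
              (leaf∈S , sym G leaf-adj , matchEdge-leaf partner)
            byCases (no x≢l) (no x≢s) = subst (Matched x) (≡.sym (matchEdge-pruned partner x∈))
              (proj₁ (∈pruned⁻ (partner-∈ x∈)) , partner-adj x∈ ,
               trans (matchEdge-pruned partner (partner-∈ x∈)) (partner-involutive x∈))
              where
                x∈ : x ∈ pruned
                x∈ = ∈pruned⁺ x∈S x≢l x≢s

  open Pruning

  -- Forests

  module _ (acyclic : Acyclic G) where

    endpoint-¬adj-beyondSuccessor : ∀ {x a ws y} → Unique (x ∷ a ∷ ws) → Chain G (x ∷ a ∷ ws) →
                                    y ∈ₗ ws → ¬ Adj G x y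
    endpoint-¬adj-beyondSuccessor {x} {a} {y = y} u ch y∈ws xy with ∈-∃++ y∈ws
    ... | ys , zs , refl = acyclic _ (closedPath⇒cycle ys (unique-++⁻ˡ prefix (subst Unique split u))
                                                          (chain-++⁻ˡ prefix (subst (Chain G) split ch))
                                                          (sym G xy))
      where
        prefix : List (Fin n)
        prefix = x ∷ a ∷ ys ++ y ∷ []
        split : x ∷ a ∷ ys ++ y ∷ zs ≡ prefix ++ zs
        split = cong (λ l → x ∷ a ∷ l) (≡.sym (++-assoc ys (y ∷ []) zs))

    stuckEndpoint⇒leaf : ∀ {S w} ws → Unique (w ∷ ws) → Chain G (w ∷ ws) →
                         (∀ {y} → y ∈ S → Adj G w y → y ∈ₗ w ∷ ws) → ∃ (LeafIn S w)
    stuckEndpoint⇒leaf {w = w} [] _ _ onPath = w , λ y∈S wy → case onPath y∈S wy of λ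
      { (here refl) → contradiction wy (irrefl G)
      ; (there ())
      }
    stuckEndpoint⇒leaf (a ∷ _) u ch onPath = a , λ y∈S wy → case onPath y∈S wy of λ
      { (here refl)          → contradiction wy (irrefl G)
      ; (there (here y≡a))   → y≡a
      ; (there (there y∈ws)) → contradiction wy (endpoint-¬adj-beyondSuccessor u ch y∈ws)
      }

    extendPathToLeaf : ∀ {S} (R : Subset n) → Acc _⊂_ R →
                       ∀ {w} ws → w ∈ S → Unique (w ∷ ws) → Chain G (w ∷ ws) →
                       (∀ {y} → y ∈ S → y ∉ₗ w ∷ ws → y ∈ R) →
                       ∃₂ λ v s → v ∈ S × LeafIn S v s
    extendPathToLeaf {S} R (acc rec) {w} ws w∈S u ch offPath∈R
      with any? (λ y → y ∈? S ×-dec adj? G w y ×-dec ¬? (anyₗ? (y ≟_) (w ∷ ws)))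
    ... | yes (y , y∈S , wy , y∉) =
      extendPathToLeaf (R - y) (rec (x∈p⇒p-x⊂p (offPath∈R y∈S y∉)))
        (w ∷ ws) y∈S (¬Any⇒All¬ _ y∉ ∷ u) (sym G wy ∷ ch)
        λ y′∈S y′∉ → x∈p∧x≢y⇒x∈p-y (offPath∈R y′∈S (y′∉ ∘ there)) (y′∉ ∘ here)
    ... | no stuck = let s , leaf = stuckEndpoint⇒leaf ws u ch onPath in w , s , w∈S , leaf
      where
        onPath : ∀ {y} → y ∈ S → Adj G w y → y ∈ₗ w ∷ ws
        onPath {y} y∈S wy =
          decidable-stable (anyₗ? (y ≟_) (w ∷ ws)) λ y∉ → stuck (y , y∈S , wy , y∉)

    leafIn-exists : ∀ {S x} → x ∈ S → ∃₂ λ v s → v ∈ S × LeafIn S v s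
    leafIn-exists {S} {x} x∈S =
      extendPathToLeaf S (⊂-wellFounded S) [] x∈S ([] ∷ []) [ x ] λ y∈S _ → y∈S

    isolated-or-leafEdge : ∀ {S x} → x ∈ S → (∃ λ v → v ∈ S × IsolatedIn S v) ⊎ LeafEdgeIn S
    isolated-or-leafEdge {S} x∈S with leafIn-exists x∈S
    ... | v , s , v∈S , leaf with s ∈? S ×-dec adj? G v s
    ...   | yes (s∈S , vs) = inj₂ record
      { leaf = v ; support = s ; leaf∈S = v∈S ; support∈S = s∈S ; leaf-adj = vs ; leaf-only = leaf }
    ...   | no ¬edge = inj₁ (v , v∈S , λ y∈S vy →
      ¬edge (subst (_∈ S) (leaf y∈S vy) y∈S , subst (Adj G v) (leaf y∈S vy) vy))

    matching-or-¬aliceWinsOnB : ∀ {S} → Acc _⊂_ S →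
                                PerfectMatchingOn S ⊎ ¬ AliceWinsOn S 2 (empty G) bob
    matching-or-¬aliceWinsOnB {S} (acc rec) with nonempty? S
    ... | no ∅ = inj₁ (emptyMatching ∅)
    ... | yes (x , x∈S) with isolated-or-leafEdge x∈S
    ...   | inj₁ (v , v∈S , iso) =
      inj₂ (undominatable⇒¬aliceWinsOn zero (isolated⇒¬dominating v∈S iso))
    ...   | inj₂ e with matching-or-¬aliceWinsOnB (rec (pruned⊂S e))
    ...     | inj₁ m       = inj₁ (extendMatching e m)
    ...     | inj₂ bobWins = inj₂ (bobWins ∘ aliceWinsOn-pruned e (refl , refl))

    ¬aliceWinsOnA : ∀ {S} → Acc _⊂_ S → Nonempty S → ¬ AliceWinsOn S 2 (empty G) alice
    ¬aliceWinsOnA (acc rec) (x , x∈S) with isolated-or-leafEdge x∈S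
    ... | inj₁ (v , v∈S , iso) = undominatable⇒¬aliceWinsOn zero (isolated⇒¬dominating v∈S iso)
    ... | inj₂ e with nonempty? (pruned e)
    ...   | yes ne = ¬aliceWinsOnA (rec (pruned⊂S e)) ne ∘ aliceWinsOn-pruned e (refl , refl)
    ...   | no ∅   = onlyEdge⇒¬aliceWinsOn e ∅ (refl , refl)

    aliceWinsB⇒perfectMatching : AliceWinsBGame G 2 → PerfectMatching G
    aliceWinsB⇒perfectMatching wins with matching-or-¬aliceWinsOnB (⊂-wellFounded ⊤)
    ... | inj₁ m       = perfectMatchingOn⊤⇒perfectMatching m
    ... | inj₂ bobWins = contradiction (aliceWins⇒aliceWinsOn⊤ wins) bobWins

    ¬aliceWinsA-palette2 : Fin n → ¬ AliceWinsAGame G 2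
    ¬aliceWinsA-palette2 x = ¬aliceWinsOnA (⊂-wellFounded ⊤) (x , ∈⊤) ∘ aliceWins⇒aliceWinsOn⊤

    ¬aliceWins-palette≥3 : Fin n → ∀ {k} → 2 < k → ∀ {p pl} → ¬ AliceWins G k p pl
    ¬aliceWins-palette≥3 x (s≤s (s≤s (s≤s _))) with leafIn-exists (∈⊤ {x = x})
    ... | _ , _ , v∈⊤ , leaf =
      undominatable⇒¬aliceWinsOn zero (leaf⇒¬dominating v∈⊤ leaf) ∘ aliceWins⇒aliceWinsOn⊤

  -- Strategies for Alice

  UncolouredWithin : ∀ {k} → Subset n → Position G k → Set
  UncolouredWithin U p = ∀ {x} → p x ≡ nothing → x ∈ U

  uncolouredWithin-update : ∀ {k U} {p : Position G k} {v c} → p v ≡ nothing →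
                            UncolouredWithin U p → UncolouredWithin (U - v) (update G p v c)
  uncolouredWithin-update {p = p} {v} {c} pv within {x} qx =
    x∈p∧x≢y⇒x∈p-y (within (trans (≡.sym (update-≢ p c x≢v)) qx)) x≢v
    where
      x≢v : x ≢ v
      x≢v refl = case trans (≡.sym qx) (update-≡ p x c) of λ ()

  module _ {k} (c₀ : Fin k)
           (allColoured⇒win : ∀ {p : Position G k} → AllColoured G p → AliceWinCondition G p) where

    allColouringsWin⇒aliceWins : ∀ {U} → Acc _⊂_ U → ∀ {p} → UncolouredWithin U p →
                                 ∀ pl → AliceWins G k p pl
    allColouringsWin⇒aliceWins (acc rec) {p} within pl with uncolouredIn? ⊤ p
    ... | no none          = finished all (allColoured⇒win all)
      where
        all : AllColoured G p
        all = ¬uncoloured⇒allColoured none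
    ... | yes (v , _ , pv) = move pl
      where
        continue : ∀ {v} c → p v ≡ nothing → ∀ pl → AliceWins G k (update G p v c) pl
        continue c pv =
          allColouringsWin⇒aliceWins (rec (x∈p⇒p-x⊂p (within pv))) (uncolouredWithin-update pv within)
        move : ∀ pl → AliceWins G k p pl
        move alice = aliceMove v c₀ pv (continue c₀ pv bob)
        move bob   = bobMove (uncoloured⇒¬allColoured pv) λ _ c pv′ → continue c pv′ alice

  oneColour-dominates : ∀ {p : Position G 1} → AllColoured G p → AliceWinCondition G p
  oneColour-dominates all x zero with all x
  ... | zero , px = x , inj₁ refl , px

  aliceWinsA-palette1 : AliceWinsAGame G 1
  aliceWinsA-palette1 =
    allColouringsWin⇒aliceWins zero oneColour-dominates (⊂-wellFounded ⊤) (λ _ → ∈⊤) alice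

  module _ (m : PerfectMatchingOn ⊤) where
    open PerfectMatchingOn m

    partner-flip : ∀ {x y} → partner x ≡ y → x ≡ partner y
    partner-flip e = trans (≡.sym (partner-involutive ∈⊤)) (cong partner e)

    partner-injective : ∀ {x y} → partner x ≡ partner y → x ≡ y
    partner-injective e = trans (partner-flip e) (partner-involutive ∈⊤)

    partner-≢ : ∀ x → x ≢ partner x
    partner-≢ x x≡px = irrefl G (subst (Adj G x) (≡.sym x≡px) (partner-adj ∈⊤))

    Paired : Position G 2 → Set
    Paired p = ∀ x → p (partner x) ≡ mapMaybe opposite (p x)

    paired⇒dominating : ∀ {p} → AllColoured G p → Paired p → AliceWinCondition G p
    paired⇒dominating all paired x c with all x
    ... | d , px with ≡-or-≡-opposite c d
    ...   | inj₁ refl = x , inj₁ refl , px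
    ...   | inj₂ refl =
      partner x , inj₂ (partner-adj ∈⊤) , trans (paired x) (cong (mapMaybe opposite) px)

    paired-answer : ∀ {p v c} → Paired p → p v ≡ nothing →
                    Paired (update G (update G p v c) (partner v) (opposite c))
    paired-answer {p} {v} {c} paired pv x = byCases (x ≟ v) (x ≟ partner v)
      where
        q r : Position G 2
        q = update G p v c
        r = update G q (partner v) (opposite c)
        r-v : r v ≡ just c
        r-v = trans (update-≢ q (opposite c) (partner-≢ v)) (update-≡ p v c)
        r-partner : r (partner v) ≡ just (opposite c)
        r-partner = update-≡ q (partner v) (opposite c)
        r-elsewhere : ∀ {y} → y ≢ v → y ≢ partner v → r y ≡ p y
        r-elsewhere y≢v y≢pv = trans (update-≢ q (opposite c) y≢pv) (update-≢ p c y≢v)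
        byCases : Dec (x ≡ v) → Dec (x ≡ partner v) → r (partner x) ≡ mapMaybe opposite (r x)
        byCases (yes refl) _ = trans r-partner (cong (mapMaybe opposite) (≡.sym r-v))
        byCases (no _) (yes refl) = begin
          r (partner (partner v))               ≡⟨ cong r (partner-involutive ∈⊤) ⟩
          r v                                   ≡⟨ r-v ⟩
          just c                                ≡⟨ cong just (opposite-involutive c) ⟨
          mapMaybe opposite (just (opposite c)) ≡⟨ cong (mapMaybe opposite) r-partner ⟨
          mapMaybe opposite (r (partner v))     ∎
        byCases (no x≢v) (no x≢pv) = begin
          r (partner x)           ≡⟨ r-elsewhere (x≢pv ∘ partner-flip) (x≢v ∘ partner-injective) ⟩
          p (partner x)           ≡⟨ paired x ⟩
          mapMaybe opposite (p x) ≡⟨ cong (mapMaybe opposite) (r-elsewhere x≢v x≢pv) ⟨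
          mapMaybe opposite (r x) ∎

    paired⇒aliceWins : ∀ {U} → Acc _⊂_ U → ∀ {p} → UncolouredWithin U p → Paired p →
                       AliceWins G 2 p bob
    paired⇒aliceWins (acc rec) {p} within paired with uncolouredIn? ⊤ p
    ... | no none          = finished all (paired⇒dominating all paired)
      where
        all : AllColoured G p
        all = ¬uncoloured⇒allColoured none
    ... | yes (_ , _ , pv) = bobMove (uncoloured⇒¬allColoured pv) answer
      where
        answer : ∀ v c → p v ≡ nothing → AliceWins G 2 (update G p v c) alice
        answer v c pv = aliceMove (partner v) (opposite c) qpv
          (paired⇒aliceWins (rec (⊂-trans (x∈p⇒p-x⊂p (within′ qpv)) (x∈p⇒p-x⊂p (within pv))))
                            (uncolouredWithin-update qpv within′) (paired-answer paired pv))
          where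
            within′ : UncolouredWithin (_ - v) (update G p v c)
            within′ = uncolouredWithin-update pv within
            qpv : update G p v c (partner v) ≡ nothing
            qpv = trans (update-≢ p c (partner-≢ v ∘ ≡.sym))
                        (trans (paired v) (cong (mapMaybe opposite) pv))

  perfectMatching⇒aliceWinsB : PerfectMatching G → AliceWinsBGame G 2
  perfectMatching⇒aliceWinsB pm =
    paired⇒aliceWins (perfectMatching⇒perfectMatchingOn⊤ pm) (⊂-wellFounded ⊤) (λ _ → ∈⊤) (λ _ → refl)

theorem5p2 : ∀ (n : ℕ) (T : Graph n) → n ≥ 2 → IsTree T →
    (DelayedGameDomaticNumberIs T 2 ⇔ HasPerfectMatching T)
      × GameDomaticNumberIs T 1
theorem5p2 zero    T () _
theorem5p2 (suc n) T _  (_ , acyclic) =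
  mk⇔ (aliceWinsB⇒perfectMatching T acyclic ∘ proj₁)
      (λ pm → perfectMatching⇒aliceWinsB T pm , λ _ 2<k → ¬aliceWins-palette≥3 T acyclic zero 2<k)
  , aliceWinsA-palette1 T , ¬aliceWinsA-palette>1
  where
    ¬aliceWinsA-palette>1 : ∀ k → 1 < k → ¬ AliceWinsAGame T k
    ¬aliceWinsA-palette>1 (suc zero)          (s≤s ())
    ¬aliceWinsA-palette>1 (suc (suc zero))    _ = ¬aliceWinsA-palette2 T acyclic zero
    ¬aliceWinsA-palette>1 (suc (suc (suc k))) _ =
      ¬aliceWins-palette≥3 T acyclic zero (s≤s (s≤s (s≤s z≤n)))
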